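{- Let $\sigma\in\mathfrak{S}_n$ and let $\theta(\sigma)=(s,\gamma)$ be its Laguerre history encoding, with $s=s_1\cdots s_n$ and $\gamma_i=(\xi_i,\eta_i)$. Then (i) $\mathrm{Arec}^{p}(s,\gamma)=\mathrm{Arec}^{p}\sigma$; (ii) $\mathrm{Erec}^{l}(s,\gamma)=\mathrm{Erec}^{l}\sigma$; (iii) $\mathrm{Rar}(s,\gamma)=\mathrm{Rar}\,\sigma$; (iv) $\mathrm{Exc}^{p}(s,\gamma)=\mathrm{Exc}^{p}\sigma$; (v) $\mathrm{Exc}^{l}(s,\gamma)=\mathrm{Exc}^{l}\sigma$; (vi) $\mathrm{Cyc}(s,\gamma)=\mathrm{Cyc}\,\sigma$.
   Context: $\mathfrak{S}_n$ is the set of permutations of $[n]$. For $\sigma\in\mathfrak{S}_n$: $i$ is a cycle peak if $\sigma^{ -1}(i)<i>\sigma(i)$, cycle valley if $\sigma^{ -1}(i)>i<\sigma(i)$, cycle double rise if $\sigma^{ -1}(i)<i<\sigma(i)$, cycle double fall if $\sigma^{ -1}(i)>i>\sigma(i)$, fixed point if $\sigma(i)=i$. Let $\mathrm{lownest}(i,\sigma)=\#\{j:\sigma(j)<\sigma(i),\ i<j\}$ and $\mathrm{upnest}(i,\sigma)=\#\{j:\sigma^{ -1}(j)<\sigma^{ -1}(i),\ i<j\}$. The encoding $\theta(\sigma)=(s,\gamma)$ is the word $s=s_1\cdots s_n$ over $\{U,D,L_a,L_b,L_c\}$ together with $\gamma=(\gamma_1,\dots,\gamma_n)$, $\gamma_i=(\xi_i,\eta_i)$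 (entries in positive integers or a symbol $\Delta$), given by: $(s_i,\gamma_i)=(U,(\Delta,\Delta))$ if $i$ is a cycle valley; $(D,(\mathrm{upnest}(i,\sigma)+1,\mathrm{lownest}(i,\sigma)+1))$ if $i$ is a cycle peak; $(L_a,(\mathrm{upnest}(i,\sigma)+1,\Delta))$ if $i$ is a cycle double rise; $(L_b,(\Delta,\mathrm{lownest}(i,\sigma)+1))$ if $i$ is a cycle double fall; $(L_c,(\Delta,h_{i-1}+1))$ if $i$ is a fixed point, where $h_j$ is the number of letters $U$ minus the number of letters $D$ in $s_1\cdots s_j$ ($h_0=0$). Statistics on $(s,\gamma)$: $\mathrm{Arec}^{p}(s,\gamma)=\{i:s_i\in\{D,L_b,L_c\},\ \eta_i=1\}$; $\mathrm{Erec}^{l}(s,\gamma)=\{i:s_i\in\{D,L_a\},\ \xi_i=1\}$; $\mathrm{Rar}(s,\gamma)=\{i:s_i=L_c,\ \eta_i=1\}$; $\mathrm{Exc}^{p}(s,\gamma)=\{i:s_i\in\{U,L_a\}\}$; $\mathrm{Exc}^{l}(s,\gamma)=\{i:s_i\in\{D,L_a\}\}$; $\mathrm{Cyc}(s,\gamma)$ is the set of $i$ such that either $s_i=L_c$, or $s_i=D$ and there exist $i_1,\dots,i_k\in\{1,\dots,i\}$ with $\sigma(i)=i_1,\sigma(i_1)=i_2,\dots,\sigma(i_k)=i$. Statistics on $\sigma$: $\mathrm{Arec}^{p}\sigma=\{i:\sigma(j)>\sigma(i)\ \forall j>i\}$; a pair $(i,\sigma(i))$ is a record if $\sigma(j)<\sigma(i)$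 for all $j<i$, an antirecord if $\sigma(j)>\sigma(i)$ for all $j>i$, an exclusive record if a record but not an antirecord; $\mathrm{Erec}^{l}\sigma=\{\sigma(i):(i,\sigma(i))\text{ exclusive record}\}$; $\mathrm{Rar}\,\sigma=\{i:(i,\sigma(i))\text{ is both a record and an antirecord}\}$; $\mathrm{Exc}^{p}\sigma=\{i:\sigma(i)>i\}$, $\mathrm{Exc}^{l}\sigma=\{\sigma(i):\sigma(i)>i\}$; $\mathrm{Cyc}\,\sigma$ is the set of cycle maxima of $\sigma$. -}

module Defs where

open import Data.Nat using (ℕ; zero; suc; _≤_; _<_; _<?_)
open import Data.Nat.Properties using (_≟_)
open import Data.Integer using (ℤ; +_; _-_; _+_)
open import Data.Fin using (Fin; toℕ)
open import Data.Fin.Permutation using (Permutation′; _⟨$⟩ʳ_; _⟨$⟩ˡ_)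
open import Data.List using (List; length; filter; allFin)
open import Data.Maybe using (Maybe; just; nothing)
open import Data.Product using (_×_; _,_; proj₁; proj₂; ∃-syntax)
open import Data.Sum using (_⊎_)
open import Relation.Nullary using (yes; no)
open import Relation.Nullary.Decidable using (_×-dec_)
open import Relation.Unary using (Decidable)
open import Relation.Binary.PropositionalEquality using (_≡_)

-- Positions/values [n] = {1,…,n} are modelled by Fin n = {0,…,n-1};
-- the shift by one preserves the order, which is all that matters.

count : ∀ {n} {P : Fin n → Set} → Decidable P → ℕ
count {n} P? = length (filter P? (allFin n))

pow : ∀ {n} → Permutation′ n → ℕ → Fin n → Fin n
pow σ zero    i = i
pow σ (suc m) i = σ ⟨$⟩ʳ pow σ m i

data Letter : Set where
  U D La Lb Lc : Letter

-- γ_i = (ξ_i , η_i), with Δ represented by nothing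
Weight : Set
Weight = Maybe ℤ × Maybe ℤ

Encoding : ℕ → Set
Encoding n = (Fin n → Letter) × (Fin n → Weight)

module _ {n : ℕ} (σ : Permutation′ n) where

  -- type of i: fixed point, cycle peak/valley/double rise/double fall
  letter : Fin n → Letter
  letter i with toℕ (σ ⟨$⟩ʳ i) ≟ toℕ i
  ... | yes _ = Lc
  ... | no _ with toℕ (σ ⟨$⟩ˡ i) <? toℕ i | toℕ (σ ⟨$⟩ʳ i) <? toℕ i
  ... | yes _ | yes _ = D
  ... | yes _ | no _  = La
  ... | no _  | yes _ = Lb
  ... | no _  | no _  = U

  lownest : Fin n → ℕ
  lownest i = count (λ j → (toℕ (σ ⟨$⟩ʳ j) <? toℕ (σ ⟨$⟩ʳ i)) ×-dec (toℕ i <? toℕ j))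

  upnest : Fin n → ℕ
  upnest i = count (λ j → (toℕ (σ ⟨$⟩ˡ j) <? toℕ (σ ⟨$⟩ˡ i)) ×-dec (toℕ i <? toℕ j))

  isU? : ∀ j → Relation.Nullary.Dec (letter j ≡ U)
  isU? j with letter j
  ... | U  = yes Relation.Binary.PropositionalEquality.refl
  ... | D  = no (λ ())
  ... | La = no (λ ())
  ... | Lb = no (λ ())
  ... | Lc = no (λ ())

  isD? : ∀ j → Relation.Nullary.Dec (letter j ≡ D)
  isD? j with letter j
  ... | U  = no (λ ())
  ... | D  = yes Relation.Binary.PropositionalEquality.refl
  ... | La = no (λ ())
  ... | Lb = no (λ ())
  ... | Lc = no (λ ())

  -- h_{i-1} = #U − #D among s_1 ⋯ s_{i-1}, i.e. among positions j < i
  hBefore : Fin n → ℤ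
  hBefore i = + count (λ j → (toℕ j <? toℕ i) ×-dec isU? j)
            - + count (λ j → (toℕ j <? toℕ i) ×-dec isD? j)

  weight : Fin n → Weight
  weight i with letter i
  ... | U  = nothing , nothing
  ... | D  = just (+ suc (upnest i)) , just (+ suc (lownest i))
  ... | La = just (+ suc (upnest i)) , nothing
  ... | Lb = nothing , just (+ suc (lownest i))
  ... | Lc = nothing , just (hBefore i + + 1)

  θ : Encoding n
  θ = letter , weight

module _ {n : ℕ} (e : Encoding n) where
  private
    s = proj₁ e
    ξ = λ i → proj₁ (proj₂ e i)
    η = λ i → proj₂ (proj₂ e i)

  ArecpE : Fin n → Set
  ArecpE i = (s i ≡ D ⊎ s i ≡ Lb ⊎ s i ≡ Lc) × η i ≡ just (+ 1)

  EreclE : Fin n → Set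
  EreclE i = (s i ≡ D ⊎ s i ≡ La) × ξ i ≡ just (+ 1)

  RarE : Fin n → Set
  RarE i = s i ≡ Lc × η i ≡ just (+ 1)

  ExcpE : Fin n → Set
  ExcpE i = s i ≡ U ⊎ s i ≡ La

  ExclE : Fin n → Set
  ExclE i = s i ≡ D ⊎ s i ≡ La

-- Cyc(s,γ): s_i = L_c, or s_i = D and there are i_1,…,i_k ∈ {1,…,i}
-- (k ≥ 1) with σ(i) = i_1, σ(i_1) = i_2, …, σ(i_k) = i;
-- here i_m = σ^m(i).
CycE : ∀ {n} → Permutation′ n → Encoding n → Fin n → Set
CycE σ e i = proj₁ e i ≡ Lc
  ⊎ (proj₁ e i ≡ D ×
     ∃[ k ] (1 ≤ k × pow σ (suc k) i ≡ i
             × (∀ m → 1 ≤ m → m ≤ k → toℕ (pow σ m i) ≤ toℕ i)))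

module _ {n : ℕ} (σ : Permutation′ n) where

  IsRecord : Fin n → Set
  IsRecord i = ∀ j → toℕ j < toℕ i → toℕ (σ ⟨$⟩ʳ j) < toℕ (σ ⟨$⟩ʳ i)

  IsAntirecord : Fin n → Set
  IsAntirecord i = ∀ j → toℕ i < toℕ j → toℕ (σ ⟨$⟩ʳ i) < toℕ (σ ⟨$⟩ʳ j)

  Arecp : Fin n → Set
  Arecp i = IsAntirecord i

  IsExclusiveRecord : Fin n → Set
  IsExclusiveRecord i = IsRecord i × (IsAntirecord i → Data.Empty.⊥)
    where import Data.Empty

  Erecl : Fin n → Set
  Erecl v = ∃[ i ] (σ ⟨$⟩ʳ i ≡ v × IsExclusiveRecord i)

  Rar : Fin n → Set
  Rar i = IsRecord i × IsAntirecord i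

  Excp : Fin n → Set
  Excp i = toℕ i < toℕ (σ ⟨$⟩ʳ i)

  Excl : Fin n → Set
  Excl v = ∃[ i ] (σ ⟨$⟩ʳ i ≡ v × toℕ i < toℕ (σ ⟨$⟩ʳ i))

  Cyc : Fin n → Set
  Cyc i = ∀ m → toℕ (pow σ m i) ≤ toℕ i

-- Every statistic of (s , γ) is decided by the letter s_i, i.e. by the shape
-- of i in σ (fixed point, cycle peak, valley, double rise or double fall, see
-- Shape), together with a weight that equals 1 exactly when a count vanishes:
--   * lownest(i) = 0 iff i is an antirecord, upnest(v) = 0 iff σ⁻¹(v) is a record;
--   * h_{i-1} = #{ j < i | σ(j) ≥ i } (height-crossing), so for a fixed point i
--     the weight h_{i-1} + 1 is 1 iff σ maps {j | j < i} into itself, i.e. iff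
--     i is a record.
-- The only genuinely combinatorial input is the pigeonhole lemma stable-flip:
-- if σ maps an initial segment into itself, so does σ⁻¹.  It gives k ≤ σ(k)
-- for records, σ(k) ≤ k for antirecords, and record ⇔ antirecord at fixed
-- points.  Cycle maxima are handled through the periodicity of orbits.
module Submission where

open import Defs
open import Data.Nat using (ℕ; zero; suc; _+_; _∸_; _≤_; _<_; _≤?_; _<?_; z≤n; s≤s; s≤s⁻¹)
open import Data.Nat.Properties
open import Data.Nat.Tactic.RingSolver using (solve-∀)
import Data.Integer as ℤ
open import Data.Integer.Properties using ([+m]-[+n]≡m⊖n; ⊖-≥) renaming (+-injective to ℤ+-injective)
open import Data.Fin using (Fin; zero; suc; toℕ; fromℕ<; inject≤; punchIn)
open import Data.Fin.Properties
  using (toℕ-injective; toℕ<n; toℕ-fromℕ<; toℕ-inject≤; inject≤-injective; fromℕ<-injective;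
         punchInᵢ≢i; injective⇒≤; pigeonhole)
open import Data.Fin.Permutation using (Permutation′; _⟨$⟩ʳ_; _⟨$⟩ˡ_; inverseˡ; inverseʳ; flip)
open import Data.List using (length; filter; tabulate)
open import Data.List.Properties using (filter-some; filter-none)
import Data.List.Relation.Unary.All.Properties as All
import Data.List.Relation.Unary.Any.Properties as Any
open import Data.Product using (_×_; _,_; proj₁; proj₂; ∃-syntax)
open import Data.Maybe using (just)
open import Data.Maybe.Properties using (just-injective)
open import Data.Sum using (_⊎_; inj₁; inj₂; [_,_])
open import Function using (_∘_)
open import Function.Bundles using (_⇔_; mk⇔; Equivalence)
import Function.Properties.Equivalence as ⇔
open import Relation.Nullary using (Dec; yes; no; ¬_; contradiction)
open import Relation.Nullary.Decidable using (_×-dec_)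
open import Relation.Unary using (Decidable)
open import Relation.Binary.PropositionalEquality
  using (_≡_; _≢_; refl; sym; trans; cong; cong₂; subst; subst₂; module ≡-Reasoning)
open import Algebra.Properties.CommutativeMonoid.Sum +-0-commutativeMonoid
  using (sum; sum-cong-≗; ∑-distrib-+; sum-remove; sum-replicate-zero)

open Equivalence using (to; from)

true-×⇔ : {A B : Set} → A → (A × B) ⇔ B
true-×⇔ a = mk⇔ proj₂ (a ,_)

false⇔false : {A B : Set} → ¬ A → ¬ B → A ⇔ B
false⇔false ¬a ¬b = mk⇔ (λ a → contradiction a ¬a) (λ b → contradiction b ¬b)

just⇔ : {A : Set} {x y : A} → just x ≡ just y ⇔ x ≡ y
just⇔ = mk⇔ just-injective (cong just)

weight-one⇔ : ∀ {m} → just (ℤ.+ suc m) ≡ just (ℤ.+ 1) ⇔ m ≡ 0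
weight-one⇔ = mk⇔ (λ { refl → refl }) (λ { refl → refl })

≮∧≢⇒> : ∀ {x y} → ¬ x < y → x ≢ y → y < x
≮∧≢⇒> x≮y x≢y = ≤∧≢⇒< (≮⇒≥ x≮y) (x≢y ∘ sym)

⟦_⟧ : {P : Set} → Dec P → ℕ
⟦ yes _ ⟧ = 1
⟦ no _ ⟧ = 0

indicator-yes : {P : Set} → P → (d : Dec P) → ⟦ d ⟧ ≡ 1
indicator-yes p (yes _) = refl
indicator-yes p (no ¬p) = contradiction p ¬p

indicator-no : {P : Set} → ¬ P → (d : Dec P) → ⟦ d ⟧ ≡ 0
indicator-no ¬p (yes p) = contradiction p ¬p
indicator-no ¬p (no _) = refl

indicator-cong : {P Q : Set} → P ⇔ Q → (p : Dec P) (q : Dec Q) → ⟦ p ⟧ ≡ ⟦ q ⟧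
indicator-cong P⇔Q (yes _) (yes _) = refl
indicator-cong P⇔Q (yes p) (no ¬q) = contradiction (to P⇔Q p) ¬q
indicator-cong P⇔Q (no ¬p) (yes q) = contradiction (from P⇔Q q) ¬p
indicator-cong P⇔Q (no _) (no _) = refl

indicator-⊎ : {R P Q : Set} → R ⇔ (P ⊎ Q) → (P → ¬ Q) →
  (r : Dec R) (p : Dec P) (q : Dec Q) → ⟦ r ⟧ ≡ ⟦ p ⟧ + ⟦ q ⟧
indicator-⊎ R⇔P⊎Q disj (yes r) (yes p) (yes q) = contradiction q (disj p)
indicator-⊎ R⇔P⊎Q disj (yes r) (yes p) (no _) = refl
indicator-⊎ R⇔P⊎Q disj (yes r) (no _) (yes q) = refl
indicator-⊎ R⇔P⊎Q disj (yes r) (no ¬p) (no ¬q) = contradiction (to R⇔P⊎Q r) [ ¬p , ¬q ]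
indicator-⊎ R⇔P⊎Q disj (no ¬r) (yes p) _ = contradiction (from R⇔P⊎Q (inj₁ p)) ¬r
indicator-⊎ R⇔P⊎Q disj (no ¬r) (no _) (yes q) = contradiction (from R⇔P⊎Q (inj₂ q)) ¬r
indicator-⊎ R⇔P⊎Q disj (no _) (no _) (no _) = refl

module _ {n : ℕ} where

  filter-tabulate : ∀ {m} {P : Fin n → Set} (P? : Decidable P) (f : Fin m → Fin n) →
    length (filter P? (tabulate f)) ≡ sum (λ j → ⟦ P? (f j) ⟧)
  filter-tabulate {zero} P? f = refl
  filter-tabulate {suc m} P? f with P? (f zero)
  ... | yes _ = cong suc (filter-tabulate P? (f ∘ suc))
  ... | no _ = filter-tabulate P? (f ∘ suc)

  count≡sum : {P : Fin n → Set} (P? : Decidable P) → count P? ≡ sum (λ j → ⟦ P? j ⟧)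
  count≡sum P? = filter-tabulate P? (λ j → j)

  count-zero⇔ : {P : Fin n → Set} (P? : Decidable P) → count P? ≡ 0 ⇔ (∀ j → ¬ P j)
  count-zero⇔ P? = mk⇔
    (λ c j p → <⇒≢ (filter-some P? (Any.tabulate⁺ j p)) (sym c))
    (λ none → cong length (filter-none P? (All.tabulate⁺ none)))

  count-⊎ : {R P Q : Fin n → Set} (R? : Decidable R) (P? : Decidable P) (Q? : Decidable Q) →
    (∀ j → R j ⇔ (P j ⊎ Q j)) → (∀ j → P j → ¬ Q j) → count R? ≡ count P? + count Q?
  count-⊎ R? P? Q? split disj = begin
    count R?              ≡⟨ count≡sum R? ⟩
    sum r                 ≡⟨ sum-cong-≗ (λ j → indicator-⊎ (split j) (disj j) (R? j) (P? j) (Q? j)) ⟩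
    sum (λ j → p j + q j) ≡⟨ ∑-distrib-+ p q ⟩
    sum p + sum q         ≡⟨ sym (cong₂ _+_ (count≡sum P?) (count≡sum Q?)) ⟩
    count P? + count Q?   ∎
    where
    open ≡-Reasoning
    r p q : Fin n → ℕ
    r j = ⟦ R? j ⟧
    p j = ⟦ P? j ⟧
    q j = ⟦ Q? j ⟧

count-singleton : ∀ {n} {Q : Fin n → Set} {R : Set} (Q? : Decidable Q) (R? : Dec R) (a : Fin n) →
  (∀ j → Q j ⇔ (j ≡ a × R)) → count Q? ≡ ⟦ R? ⟧
count-singleton {suc n} {Q} {R} Q? R? a only-a = begin
  count Q?                           ≡⟨ count≡sum Q? ⟩
  sum t                              ≡⟨ sum-remove {i = a} t ⟩
  t a + sum {n} (t ∘ punchIn a)      ≡⟨ cong (t a +_) (sum-cong-≗ {n} elsewhere) ⟩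
  t a + sum {n} (λ _ → 0)            ≡⟨ cong (t a +_) (sum-replicate-zero n) ⟩
  t a + 0                            ≡⟨ +-identityʳ (t a) ⟩
  t a                                ≡⟨ indicator-cong at-a (Q? a) R? ⟩
  ⟦ R? ⟧                             ∎
  where
  open ≡-Reasoning
  t : Fin (suc n) → ℕ
  t j = ⟦ Q? j ⟧
  elsewhere : ∀ j → t (punchIn a j) ≡ 0
  elsewhere j = indicator-no (λ q → punchInᵢ≢i a j (proj₁ (to (only-a _) q))) (Q? (punchIn a j))
  at-a : Q a ⇔ R
  at-a = mk⇔ (proj₂ ∘ to (only-a a)) (λ r → from (only-a a) (refl , r))

module _ {n : ℕ} {Q : Fin n → Set} (Q? : Decidable Q) where

  below : ℕ → ℕ
  below c = count (λ j → (toℕ j <? c) ×-dec Q? j)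

  below-zero : below 0 ≡ 0
  below-zero = from (count-zero⇔ (λ j → (toℕ j <? 0) ×-dec Q? j)) (λ j → λ { (() , _) })

  below-suc : ∀ {c} (a : Fin n) → toℕ a ≡ c → below (suc c) ≡ below c + ⟦ Q? a ⟧
  below-suc {c} a a≡c =
    trans (count-⊎ _ _ (λ j → (toℕ j ≟ c) ×-dec Q? j) split disjoint)
          (cong (below c +_) (count-singleton _ (Q? a) a at-a))
    where
    split : ∀ j → (toℕ j < suc c × Q j) ⇔ ((toℕ j < c × Q j) ⊎ (toℕ j ≡ c × Q j))
    split j = mk⇔
      (λ { (j≤c , q) → [ (λ j<c → inj₁ (j<c , q)) , (λ j≡c → inj₂ (j≡c , q)) ]
                           (m≤n⇒m<n∨m≡n (s≤s⁻¹ j≤c)) })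
      [ (λ { (j<c , q) → m<n⇒m<1+n j<c , q })
      , (λ { (j≡c , q) → s≤s (≤-reflexive j≡c) , q }) ]
    disjoint : ∀ j → toℕ j < c × Q j → ¬ (toℕ j ≡ c × Q j)
    disjoint j (j<c , _) (j≡c , _) = <-irrefl j≡c j<c
    at-a : ∀ j → (toℕ j ≡ c × Q j) ⇔ (j ≡ a × Q a)
    at-a j = mk⇔
      (λ { (j≡c , q) → let j≡a = toℕ-injective (trans j≡c (sym a≡c))
                       in j≡a , subst Q j≡a q })
      (λ { (refl , q) → a≡c , q })

Stable : ∀ {n} → Permutation′ n → ℕ → Set
Stable π k = ∀ j → toℕ j < k → toℕ (π ⟨$⟩ʳ j) < k

injective-below : ∀ {m n k} {f : Fin m → Fin n} →
  (∀ {x y} → f x ≡ f y → x ≡ y) → (∀ x → toℕ (f x) < k) → m ≤ k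
injective-below inj bound = injective⇒≤ λ {x} {y} e →
  inj (toℕ-injective (fromℕ<-injective _ _ (bound x) (bound y) e))

module _ {n : ℕ} (π : Permutation′ n) where

  ⟨$⟩ʳ-injective : ∀ {x y} → π ⟨$⟩ʳ x ≡ π ⟨$⟩ʳ y → x ≡ y
  ⟨$⟩ʳ-injective e = trans (sym (inverseˡ π)) (trans (cong (π ⟨$⟩ˡ_) e) (inverseˡ π))

  -- If a permutation maps an initial segment into itself, it maps it onto
  -- itself, so its inverse maps the segment into itself as well.  Otherwise
  -- the k positions below k together with π⁻¹ v (for some v < k) would be
  -- k + 1 points mapped injectively below k.
  stable-flip : ∀ {k} → Stable π k → Stable (flip π) k
  stable-flip {k} stable v v<k with k ≤? toℕ (π ⟨$⟩ˡ v)
  ... | no k≰ = ≰⇒> k≰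
  ... | yes k≤ = contradiction (injective-below f-injective f-below) (1+n≰n {k})
    where
    k≤n : k ≤ n
    k≤n = <⇒≤ (≤-<-trans k≤ (toℕ<n (π ⟨$⟩ˡ v)))
    points : Fin (suc k) → Fin n
    points zero = π ⟨$⟩ˡ v
    points (suc x) = inject≤ x k≤n
    points-suc-below : ∀ x → toℕ (points (suc x)) < k
    points-suc-below x = subst (_< k) (sym (toℕ-inject≤ x k≤n)) (toℕ<n x)
    points-injective : ∀ {x y} → points x ≡ points y → x ≡ y
    points-injective {zero} {zero} _ = refl
    points-injective {zero} {suc y} e =
      contradiction (subst (λ p → toℕ p < k) (sym e) (points-suc-below y)) (≤⇒≯ k≤)
    points-injective {suc x} {zero} e =
      contradiction (subst (λ p → toℕ p < k) e (points-suc-below x)) (≤⇒≯ k≤)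
    points-injective {suc x} {suc y} e = cong suc (inject≤-injective k≤n k≤n x y e)
    f-injective : ∀ {x y} → π ⟨$⟩ʳ points x ≡ π ⟨$⟩ʳ points y → x ≡ y
    f-injective = points-injective ∘ ⟨$⟩ʳ-injective
    f-below : ∀ x → toℕ (π ⟨$⟩ʳ points x) < k
    f-below zero = subst (λ w → toℕ w < k) (sym (inverseʳ π)) v<k
    f-below (suc x) = stable _ (points-suc-below x)

module _ {n : ℕ} (σ : Permutation′ n) where

  next prev : Fin n → ℕ
  next j = toℕ (σ ⟨$⟩ʳ j)
  prev j = toℕ (σ ⟨$⟩ˡ j)

  next-prev : ∀ v → next (σ ⟨$⟩ˡ v) ≡ toℕ v
  next-prev v = cong toℕ (inverseʳ σ)

  prev-next : ∀ j → prev (σ ⟨$⟩ʳ j) ≡ toℕ j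
  prev-next j = cong toℕ (inverseˡ σ)

  next-injective : ∀ {x y} → next x ≡ next y → x ≡ y
  next-injective = ⟨$⟩ʳ-injective σ ∘ toℕ-injective

  -- A record k has k ≤ σ(k): otherwise σ maps the segment below σ(k) + 1
  -- into itself, hence so does σ⁻¹, which puts k = σ⁻¹(σ(k)) below σ(k) + 1.
  record-≤ : ∀ {k} → IsRecord σ k → toℕ k ≤ next k
  record-≤ {k} rec = ≮⇒≥ λ σk<k →
    <⇒≱ σk<k (s≤s⁻¹ (subst (_< suc (next k)) (prev-next k)
                       (stable-flip σ (stable σk<k) (σ ⟨$⟩ʳ k) ≤-refl)))
    where
    stable : next k < toℕ k → Stable σ (suc (next k))
    stable σk<k j j≤σk = m<n⇒m<1+n (rec j (≤-<-trans (s≤s⁻¹ j≤σk) σk<k))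

  -- Dually an antirecord k has σ(k) ≤ k: otherwise σ⁻¹ maps the segment up
  -- to k into itself, hence so does σ.
  antirecord-≤ : ∀ {k} → IsAntirecord σ k → next k ≤ toℕ k
  antirecord-≤ {k} antirec = ≮⇒≥ λ k<σk →
    <⇒≱ k<σk (s≤s⁻¹ (stable-flip (flip σ) (stable k<σk) k ≤-refl))
    where
    stable : toℕ k < next k → Stable (flip σ) (suc (toℕ k))
    stable k<σk v v≤k = s≤s (≮⇒≥ λ k<pv →
      <-asym (≤-<-trans (s≤s⁻¹ v≤k) k<σk) (subst (next k <_) (next-prev v) (antirec _ k<pv)))

  rar-fixed : ∀ {k} → Rar σ k → next k ≡ toℕ k
  rar-fixed (rec , antirec) = ≤-antisym (antirecord-≤ antirec) (record-≤ rec)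

  module _ {k : Fin n} (fixed : next k ≡ toℕ k) where

    record⇔stable : IsRecord σ k ⇔ Stable σ (toℕ k)
    record⇔stable = mk⇔
      (λ rec j j<k → subst (next j <_) fixed (rec j j<k))
      (λ stable j j<k → subst (next j <_) (sym fixed) (stable j j<k))

    antirecord⇔stable-flip : IsAntirecord σ k ⇔ Stable (flip σ) (toℕ k)
    antirecord⇔stable-flip = mk⇔ to′ from′
      where
      to′ : IsAntirecord σ k → Stable (flip σ) (toℕ k)
      to′ antirec v v<k = ≮∧≢⇒>
        (λ k<pv → <-asym v<k (subst₂ _<_ fixed (next-prev v) (antirec _ k<pv)))
        (λ k≡pv → <-irrefl (trans (sym (next-prev v)) (trans (cong next (toℕ-injective (sym k≡pv))) fixed)) v<k)
      from′ : Stable (flip σ) (toℕ k) → IsAntirecord σ k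
      from′ stable j k<j = subst (_< next j) (sym fixed) (≮∧≢⇒>
        (λ σj<k → <-asym k<j (subst (_< toℕ k) (prev-next j) (stable _ σj<k)))
        (λ σj≡k → <-irrefl (cong toℕ (sym (next-injective (trans σj≡k (sym fixed))))) k<j))

    -- Hence, since σ maps a segment into itself iff σ⁻¹ does, a fixed point
    -- is a record iff it is an antirecord.
    record⇔antirecord : IsRecord σ k ⇔ IsAntirecord σ k
    record⇔antirecord = ⇔.trans record⇔stable
      (⇔.trans (mk⇔ (stable-flip σ) (stable-flip (flip σ))) (⇔.sym antirecord⇔stable-flip))

  lownest-zero⇔antirecord : ∀ i → lownest σ i ≡ 0 ⇔ IsAntirecord σ i
  lownest-zero⇔antirecord i = ⇔.trans (count-zero⇔ _) (mk⇔ to′ from′)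
    where
    to′ : (∀ j → ¬ (next j < next i × toℕ i < toℕ j)) → IsAntirecord σ i
    to′ none j i<j = ≮∧≢⇒> (λ σj<σi → none j (σj<σi , i<j))
      (λ σj≡σi → <-irrefl (cong toℕ (next-injective (sym σj≡σi))) i<j)
    from′ : IsAntirecord σ i → ∀ j → ¬ (next j < next i × toℕ i < toℕ j)
    from′ antirec j (σj<σi , i<j) = <-asym σj<σi (antirec j i<j)

  upnest-zero⇔record : ∀ v → upnest σ v ≡ 0 ⇔ IsRecord σ (σ ⟨$⟩ˡ v)
  upnest-zero⇔record v = ⇔.trans (count-zero⇔ _) (mk⇔ to′ from′)
    where
    to′ : (∀ w → ¬ (prev w < prev v × toℕ v < toℕ w)) → IsRecord σ (σ ⟨$⟩ˡ v)
    to′ none j j<k = subst (next j <_) (sym (next-prev v)) (≮∧≢⇒>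
      (λ v<σj → none (σ ⟨$⟩ʳ j) (subst (_< prev v) (sym (prev-next j)) j<k , v<σj))
      (λ v≡σj → <-irrefl (cong toℕ (next-injective (trans (sym v≡σj) (sym (next-prev v))))) j<k))
    from′ : IsRecord σ (σ ⟨$⟩ˡ v) → ∀ w → ¬ (prev w < prev v × toℕ v < toℕ w)
    from′ rec w (pw<pv , v<w) = <-asym v<w (subst₂ _<_ (next-prev w) (next-prev v) (rec _ pw<pv))

  prev-fixed⇔next-fixed : ∀ i → prev i ≡ toℕ i ⇔ next i ≡ toℕ i
  prev-fixed⇔next-fixed i = mk⇔
    (λ e → trans (cong next (sym (toℕ-injective e))) (next-prev i))
    (λ e → trans (cong prev (sym (toℕ-injective e))) (prev-next i))

  prev-moved : ∀ i → next i ≢ toℕ i → prev i ≢ toℕ i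
  prev-moved i σi≢i = σi≢i ∘ to (prev-fixed⇔next-fixed i)

  data Shape (i : Fin n) : Letter → Set where
    fixed      : next i ≡ toℕ i → Shape i Lc
    peak       : prev i < toℕ i → next i < toℕ i → Shape i D
    doubleRise : prev i < toℕ i → toℕ i < next i → Shape i La
    doubleFall : toℕ i < prev i → next i < toℕ i → Shape i Lb
    valley     : toℕ i < prev i → toℕ i < next i → Shape i U

  shape : ∀ i → Shape i (letter σ i)
  shape i with toℕ (σ ⟨$⟩ʳ i) ≟ toℕ i
  ... | yes σi≡i = fixed σi≡i
  ... | no σi≢i with toℕ (σ ⟨$⟩ˡ i) <? toℕ i | toℕ (σ ⟨$⟩ʳ i) <? toℕ i
  ... | yes p<i | yes s<i = peak p<i s<i
  ... | yes p<i | no s≮i = doubleRise p<i (≮∧≢⇒> s≮i σi≢i)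
  ... | no p≮i  | yes s<i = doubleFall (≮∧≢⇒> p≮i (prev-moved i σi≢i)) s<i
  ... | no p≮i  | no s≮i = valley (≮∧≢⇒> p≮i (prev-moved i σi≢i)) (≮∧≢⇒> s≮i σi≢i)

  crossing : ℕ → ℕ
  crossing c = below (λ j → c ≤? next j) c

  -- The arcs ending exactly at c contribute one iff σ⁻¹(c) < c.
  crossing-split : ∀ {c} (a : Fin n) → toℕ a ≡ c →
    crossing c ≡ below (λ j → c <? next j) c + ⟦ prev a <? c ⟧
  crossing-split {c} a a≡c =
    trans (count-⊎ _ _ (λ j → (toℕ j <? c) ×-dec (next j ≟ c)) split disjoint)
          (cong (below (λ j → c <? next j) c +_)
                (count-singleton _ (prev a <? c) (σ ⟨$⟩ˡ a) ends-at-a))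
    where
    split : ∀ j → (toℕ j < c × c ≤ next j) ⇔
                  ((toℕ j < c × c < next j) ⊎ (toℕ j < c × next j ≡ c))
    split j = mk⇔
      (λ { (j<c , c≤σj) → [ (λ c<σj → inj₁ (j<c , c<σj)) , (λ c≡σj → inj₂ (j<c , sym c≡σj)) ]
                             (m≤n⇒m<n∨m≡n c≤σj) })
      [ (λ { (j<c , c<σj) → j<c , <⇒≤ c<σj })
      , (λ { (j<c , σj≡c) → j<c , ≤-reflexive (sym σj≡c) }) ]
    disjoint : ∀ j → toℕ j < c × c < next j → ¬ (toℕ j < c × next j ≡ c)
    disjoint j (_ , c<σj) (_ , σj≡c) = <-irrefl (sym σj≡c) c<σj
    ends-at-a : ∀ j → (toℕ j < c × next j ≡ c) ⇔ (j ≡ σ ⟨$⟩ˡ a × prev a < c)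
    ends-at-a j = mk⇔
      (λ { (j<c , σj≡c) → let j≡pa = next-injective (trans σj≡c (trans (sym a≡c) (sym (next-prev a))))
                          in j≡pa , subst (_< c) (cong toℕ j≡pa) j<c })
      (λ { (refl , pa<c) → pa<c , trans (next-prev a) a≡c })

  -- Local balance at a position a: one arc may end at a (from below) and one
  -- may leave a upwards; the letter of a records the net change.
  balance : ∀ {c} (a : Fin n) → toℕ a ≡ c →
    ⟦ prev a <? c ⟧ + ⟦ isU? σ a ⟧ ≡ ⟦ isD? σ a ⟧ + ⟦ c <? next a ⟧
  balance a refl with letter σ a | shape a
  ... | Lc | fixed σa≡a = trans (cong (_+ 0) (indicator-no (<-irrefl pa≡a) _))
                                (sym (indicator-no (<-irrefl (sym σa≡a)) _))
    where pa≡a = from (prev-fixed⇔next-fixed a) σa≡a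
  ... | D  | peak p<a s<a = trans (cong (_+ 0) (indicator-yes p<a _))
                                  (cong (1 +_) (sym (indicator-no (<-asym s<a) _)))
  ... | La | doubleRise p<a a<s = trans (cong (_+ 0) (indicator-yes p<a _))
                                        (sym (indicator-yes a<s _))
  ... | Lb | doubleFall a<p s<a = trans (cong (_+ 0) (indicator-no (<-asym a<p) _))
                                        (sym (indicator-no (<-asym s<a) _))
  ... | U  | valley a<p a<s = trans (cong (_+ 1) (indicator-no (<-asym a<p) _))
                                    (sym (indicator-yes a<s _))

  height-crossing : ∀ c → c ≤ n → below (isU? σ) c ≡ below (isD? σ) c + crossing c
  height-crossing zero _ =
    trans (below-zero (isU? σ)) (sym (cong₂ _+_ (below-zero (isD? σ)) (below-zero (λ j → 0 ≤? next j))))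
  height-crossing (suc c) c<n = begin
    below (isU? σ) (suc c)                ≡⟨ below-suc (isU? σ) a a≡c ⟩
    below (isU? σ) c + u                  ≡⟨ cong (_+ u) (height-crossing c (<⇒≤ c<n)) ⟩
    Dc + crossing c + u                    ≡⟨ cong (λ x → Dc + x + u) (crossing-split a a≡c) ⟩
    Dc + (Y + e) + u                       ≡⟨ regroup Dc Y e u ⟩
    Dc + Y + (e + u)                       ≡⟨ cong (Dc + Y +_) (balance a a≡c) ⟩
    Dc + Y + (d + x)                       ≡⟨ regroup′ Dc Y d x ⟩
    Dc + d + (Y + x)                       ≡⟨ sym (cong₂ _+_ (below-suc (isD? σ) a a≡c) (below-suc _ a a≡c)) ⟩
    below (isD? σ) (suc c) + crossing (suc c) ∎
    where
    open ≡-Reasoning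
    a = fromℕ< c<n
    a≡c = toℕ-fromℕ< c<n
    Dc = below (isD? σ) c
    Y = below (λ j → c <? next j) c
    u = ⟦ isU? σ a ⟧
    d = ⟦ isD? σ a ⟧
    e = ⟦ prev a <? c ⟧
    x = ⟦ c <? next a ⟧
    regroup : ∀ p q r s → p + (q + r) + s ≡ p + q + (r + s)
    regroup = solve-∀
    regroup′ : ∀ p q r s → p + q + (r + s) ≡ p + r + (q + s)
    regroup′ = solve-∀

  height≡crossing : ∀ i → hBefore σ i ≡ ℤ.+ crossing (toℕ i)
  height≡crossing i = begin
    ℤ.+ below (isU? σ) c ℤ.- ℤ.+ Dc ≡⟨ cong (λ u → ℤ.+ u ℤ.- ℤ.+ Dc) (height-crossing c c≤n) ⟩
    ℤ.+ (Dc + X) ℤ.- ℤ.+ Dc         ≡⟨ [+m]-[+n]≡m⊖n (Dc + X) Dc ⟩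
    (Dc + X) ℤ.⊖ Dc                 ≡⟨ ⊖-≥ (m≤m+n Dc X) ⟩
    ℤ.+ (Dc + X ∸ Dc)               ≡⟨ cong ℤ.+_ (m+n∸m≡n Dc X) ⟩
    ℤ.+ X                           ∎
    where
    open ≡-Reasoning
    c = toℕ i
    c≤n = <⇒≤ (toℕ<n i)
    Dc = below (isD? σ) c
    X = crossing c

  height-zero⇔stable : ∀ i → hBefore σ i ℤ.+ ℤ.+ 1 ≡ ℤ.+ 1 ⇔ Stable σ (toℕ i)
  height-zero⇔stable i = ⇔.trans height⇔crossing (⇔.trans (count-zero⇔ _) (mk⇔ to′ from′))
    where
    height⇔crossing : hBefore σ i ℤ.+ ℤ.+ 1 ≡ ℤ.+ 1 ⇔ crossing (toℕ i) ≡ 0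
    height⇔crossing = mk⇔
      (λ h≡0 → +-cancelʳ-≡ 1 _ 0
                 (ℤ+-injective (trans (cong (ℤ._+ ℤ.+ 1) (sym (height≡crossing i))) h≡0)))
      (λ X≡0 → trans (cong (ℤ._+ ℤ.+ 1) (height≡crossing i)) (cong (λ x → ℤ.+ (x + 1)) X≡0))
    to′ : (∀ j → ¬ (toℕ j < toℕ i × toℕ i ≤ next j)) → Stable σ (toℕ i)
    to′ none j j<i = ≰⇒> (λ i≤σj → none j (j<i , i≤σj))
    from′ : Stable σ (toℕ i) → ∀ j → ¬ (toℕ j < toℕ i × toℕ i ≤ next j)
    from′ stable j (j<i , i≤σj) = <⇒≱ (stable j j<i) i≤σj

  pow-+ : ∀ a b i → pow σ (a + b) i ≡ pow σ a (pow σ b i)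
  pow-+ zero b i = refl
  pow-+ (suc a) b i = cong (σ ⟨$⟩ʳ_) (pow-+ a b i)

  pow-injective : ∀ m {x y} → pow σ m x ≡ pow σ m y → x ≡ y
  pow-injective zero e = e
  pow-injective (suc m) e = pow-injective m (⟨$⟩ʳ-injective σ e)

  -- Every orbit is periodic (pigeonhole on the first n + 1 iterates).
  period : ∀ i → ∃[ p ] (pow σ (suc p) i ≡ i)
  period i with pigeonhole (n<1+n n) (λ t → pow σ (toℕ t) i)
  ... | a , b , a<b , same = p , sym (pow-injective (toℕ a) (begin
    pow σ (toℕ a) i               ≡⟨ same ⟩
    pow σ (toℕ b) i               ≡⟨ cong (λ m → pow σ m i) b≡a+p ⟩
    pow σ (toℕ a + suc p) i       ≡⟨ pow-+ (toℕ a) (suc p) i ⟩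
    pow σ (toℕ a) (pow σ (suc p) i) ∎))
    where
    open ≡-Reasoning
    p = toℕ b ∸ suc (toℕ a)
    b≡a+p : toℕ b ≡ toℕ a + suc p
    b≡a+p = sym (trans (+-suc (toℕ a) p) (m+[n∸m]≡n a<b))

  pow-period-prev : ∀ {p} i → pow σ (suc p) i ≡ i → pow σ p i ≡ σ ⟨$⟩ˡ i
  pow-period-prev i per = trans (sym (inverseˡ σ)) (cong (σ ⟨$⟩ˡ_) per)

  orbit-within : ∀ {k} i → pow σ (suc k) i ≡ i → ∀ m → ∃[ r ] (r ≤ k × pow σ m i ≡ pow σ r i)
  orbit-within i per zero = 0 , z≤n , refl
  orbit-within {k} i per (suc m) with orbit-within i per m
  ... | r , r≤k , e with m≤n⇒m<n∨m≡n r≤k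
  ...   | inj₁ r<k = suc r , r<k , cong (σ ⟨$⟩ʳ_) e
  ...   | inj₂ refl = 0 , z≤n , trans (cong (σ ⟨$⟩ʳ_) e) per

  cycle-max-of-period : ∀ {k} i → pow σ (suc k) i ≡ i →
    (∀ m → 1 ≤ m → m ≤ k → toℕ (pow σ m i) ≤ toℕ i) → Cyc σ i
  cycle-max-of-period i per bound m with orbit-within i per m
  ... | zero , _ , e = ≤-reflexive (cong toℕ e)
  ... | suc r , r≤k , e = subst (λ x → toℕ x ≤ toℕ i) (sym e) (bound (suc r) (s≤s z≤n) r≤k)

  fixed-cycle-max : ∀ i → next i ≡ toℕ i → Cyc σ i
  fixed-cycle-max i σi≡i m = ≤-reflexive (cong toℕ (pow-fixed m))
    where
    pow-fixed : ∀ m → pow σ m i ≡ i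
    pow-fixed zero = refl
    pow-fixed (suc m) = trans (cong (σ ⟨$⟩ʳ_) (pow-fixed m)) (toℕ-injective σi≡i)

  cycle-max-prev : ∀ i → Cyc σ i → prev i ≤ toℕ i
  cycle-max-prev i max with period i
  ... | p , per = subst (_≤ toℕ i) (cong toℕ (pow-period-prev {p} i per)) (max p)

  fixed-weight-one⇔record : ∀ {i} → next i ≡ toℕ i →
    just (hBefore σ i ℤ.+ ℤ.+ 1) ≡ just (ℤ.+ 1) ⇔ IsRecord σ i
  fixed-weight-one⇔record {i} σi≡i =
    ⇔.trans just⇔ (⇔.trans (height-zero⇔stable i) (⇔.sym (record⇔stable σi≡i)))

  excedance-value⇔ : ∀ v → Excl σ v ⇔ prev v < toℕ v
  excedance-value⇔ v = mk⇔
    (λ { (k , refl , k<σk) → subst (_< next k) (sym (prev-next k)) k<σk })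
    (λ pv<v → σ ⟨$⟩ˡ v , inverseʳ σ , subst (prev v <_) (sym (next-prev v)) pv<v)

  -- An exclusive record is an excedance (a fixed record is also an antirecord).
  exclusive-record-excedance : ∀ {k} → IsExclusiveRecord σ k → toℕ k < next k
  exclusive-record-excedance (rec , ¬antirec) =
    ≤∧≢⇒< (record-≤ rec) (λ k≡σk → ¬antirec (to (record⇔antirecord (sym k≡σk)) rec))

  erecl-descent : ∀ {v} → Erecl σ v → prev v < toℕ v
  erecl-descent {v} (k , σk≡v , exclusive) =
    to (excedance-value⇔ v) (k , σk≡v , exclusive-record-excedance exclusive)

  erecl⇔record : ∀ {v} → prev v < toℕ v → Erecl σ v ⇔ IsRecord σ (σ ⟨$⟩ˡ v)
  erecl⇔record {v} pv<v = mk⇔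
    (λ { (k , refl , rec , _) → subst (IsRecord σ) (sym (inverseˡ σ)) rec })
    (λ rec → σ ⟨$⟩ˡ v , inverseʳ σ , rec , λ antirec →
      <⇒≱ pv<v (subst (_≤ prev v) (next-prev v) (antirecord-≤ antirec)))

  upnest-weight⇔erecl : ∀ {v} → prev v < toℕ v →
    just (ℤ.+ suc (upnest σ v)) ≡ just (ℤ.+ 1) ⇔ Erecl σ v
  upnest-weight⇔erecl {v} pv<v =
    ⇔.trans weight-one⇔ (⇔.trans (upnest-zero⇔record v) (⇔.sym (erecl⇔record pv<v)))

  -- Each statistic of θ(σ) is now read off from the shape of the position.
  -- (i) Arec^p: for D and L_b the weight η is lownest + 1, for L_c it is
  -- h_{i-1} + 1; positions with σ(i) > i are never antirecords.
  arec : ∀ i → ArecpE (θ σ) i ⇔ Arecp σ i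
  arec i with letter σ i | shape i
  ... | D  | peak _ _ =
    ⇔.trans (true-×⇔ (inj₁ refl)) (⇔.trans weight-one⇔ (lownest-zero⇔antirecord i))
  ... | Lb | doubleFall _ _ =
    ⇔.trans (true-×⇔ (inj₂ (inj₁ refl))) (⇔.trans weight-one⇔ (lownest-zero⇔antirecord i))
  ... | Lc | fixed σi≡i =
    ⇔.trans (true-×⇔ (inj₂ (inj₂ refl)))
            (⇔.trans (fixed-weight-one⇔record σi≡i) (record⇔antirecord σi≡i))
  ... | La | doubleRise _ i<σi = false⇔false (λ { (_ , ()) }) (<⇒≱ i<σi ∘ antirecord-≤)
  ... | U  | valley _ i<σi = false⇔false (λ { (_ , ()) }) (<⇒≱ i<σi ∘ antirecord-≤)

  -- (ii) Erec^l: for D and L_a the weight ξ is upnest + 1; other values are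
  -- not exclusive record values since σ⁻¹(v) ≥ v.
  erec : ∀ v → EreclE (θ σ) v ⇔ Erecl σ v
  erec v with letter σ v | shape v
  ... | D  | peak pv<v _ = ⇔.trans (true-×⇔ (inj₁ refl)) (upnest-weight⇔erecl pv<v)
  ... | La | doubleRise pv<v _ = ⇔.trans (true-×⇔ (inj₂ refl)) (upnest-weight⇔erecl pv<v)
  ... | Lb | doubleFall v<pv _ =
    false⇔false (λ { (inj₁ () , _) ; (inj₂ () , _) }) (<-asym v<pv ∘ erecl-descent)
  ... | U  | valley v<pv _ =
    false⇔false (λ { (inj₁ () , _) ; (inj₂ () , _) }) (<-asym v<pv ∘ erecl-descent)
  ... | Lc | fixed σv≡v = false⇔false (λ { (inj₁ () , _) ; (inj₂ () , _) })
      (<-irrefl (from (prev-fixed⇔next-fixed v) σv≡v) ∘ erecl-descent)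

  -- (iii) Rar: only fixed points can be both records and antirecords, and
  -- there a record is automatically an antirecord.
  rar : ∀ i → RarE (θ σ) i ⇔ Rar σ i
  rar i with letter σ i | shape i
  ... | Lc | fixed σi≡i = ⇔.trans (true-×⇔ refl) (⇔.trans (fixed-weight-one⇔record σi≡i)
                            (mk⇔ (λ rec → rec , to (record⇔antirecord σi≡i) rec) proj₁))
  ... | D  | peak _ σi<i = false⇔false (λ { (() , _) }) (λ r → <-irrefl (rar-fixed r) σi<i)
  ... | Lb | doubleFall _ σi<i = false⇔false (λ { (() , _) }) (λ r → <-irrefl (rar-fixed r) σi<i)
  ... | La | doubleRise _ i<σi = false⇔false (λ { (() , _) }) (λ r → <-irrefl (sym (rar-fixed r)) i<σi)
  ... | U  | valley _ i<σi = false⇔false (λ { (() , _) }) (λ r → <-irrefl (sym (rar-fixed r)) i<σi)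

  -- (iv) Exc^p: the letters U and L_a are exactly the positions with σ(i) > i.
  excp : ∀ i → ExcpE (θ σ) i ⇔ Excp σ i
  excp i with letter σ i | shape i
  ... | U  | valley _ i<σi = mk⇔ (λ _ → i<σi) (λ _ → inj₁ refl)
  ... | La | doubleRise _ i<σi = mk⇔ (λ _ → i<σi) (λ _ → inj₂ refl)
  ... | D  | peak _ σi<i = false⇔false (λ { (inj₁ ()) ; (inj₂ ()) }) (<-asym σi<i)
  ... | Lb | doubleFall _ σi<i = false⇔false (λ { (inj₁ ()) ; (inj₂ ()) }) (<-asym σi<i)
  ... | Lc | fixed σi≡i = false⇔false (λ { (inj₁ ()) ; (inj₂ ()) }) (<-irrefl (sym σi≡i))

  -- (v) Exc^l: the letters D and L_a are exactly the values with σ⁻¹(v) < v.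
  excl : ∀ v → ExclE (θ σ) v ⇔ Excl σ v
  excl v with letter σ v | shape v
  ... | D  | peak pv<v _ = mk⇔ (λ _ → from (excedance-value⇔ v) pv<v) (λ _ → inj₁ refl)
  ... | La | doubleRise pv<v _ = mk⇔ (λ _ → from (excedance-value⇔ v) pv<v) (λ _ → inj₂ refl)
  ... | Lb | doubleFall v<pv _ =
    false⇔false (λ { (inj₁ ()) ; (inj₂ ()) }) (<-asym v<pv ∘ to (excedance-value⇔ v))
  ... | U  | valley v<pv _ =
    false⇔false (λ { (inj₁ ()) ; (inj₂ ()) }) (<-asym v<pv ∘ to (excedance-value⇔ v))
  ... | Lc | fixed σv≡v = false⇔false (λ { (inj₁ ()) ; (inj₂ ()) })
      (<-irrefl (from (prev-fixed⇔next-fixed v) σv≡v) ∘ to (excedance-value⇔ v))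

  cycle-max-witness : ∀ i → next i ≢ toℕ i → Cyc σ i →
    ∃[ k ] (1 ≤ k × pow σ (suc k) i ≡ i × (∀ m → 1 ≤ m → m ≤ k → toℕ (pow σ m i) ≤ toℕ i))
  cycle-max-witness i σi≢i max with period i
  ... | zero , per = contradiction (cong toℕ per) σi≢i
  ... | suc k , per = suc k , s≤s z≤n , per , λ m _ _ → max m

  -- (vi) Cyc: fixed points are cycle maxima; for a peak the condition in the
  -- encoding says exactly that i dominates one period of its orbit; any other
  -- position lies below σ(i) or below σ⁻¹(i).
  cyc : ∀ i → CycE σ (θ σ) i ⇔ Cyc σ i
  cyc i with letter σ i | shape i
  ... | Lc | fixed σi≡i = mk⇔ (λ _ → fixed-cycle-max i σi≡i) (λ _ → inj₁ refl)
  ... | D  | peak _ σi<i = mk⇔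
    (λ { (inj₁ ()) ; (inj₂ (_ , _ , _ , per , bound)) → cycle-max-of-period i per bound })
    (λ max → inj₂ (refl , cycle-max-witness i (<⇒≢ σi<i) max))
  ... | La | doubleRise _ i<σi =
    false⇔false (λ { (inj₁ ()) ; (inj₂ (() , _)) }) (λ max → <⇒≱ i<σi (max 1))
  ... | U  | valley _ i<σi =
    false⇔false (λ { (inj₁ ()) ; (inj₂ (() , _)) }) (λ max → <⇒≱ i<σi (max 1))
  ... | Lb | doubleFall i<pi _ =
    false⇔false (λ { (inj₁ ()) ; (inj₂ (() , _)) }) (λ max → <⇒≱ i<pi (cycle-max-prev i max))

lemma6 : (n : ℕ) (σ : Permutation′ n) →
    (∀ i → ArecpE (θ σ) i ⇔ Arecp σ i)
    × (∀ i → EreclE (θ σ) i ⇔ Erecl σ i)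
    × (∀ i → RarE (θ σ) i ⇔ Rar σ i)
    × (∀ i → ExcpE (θ σ) i ⇔ Excp σ i)
    × (∀ i → ExclE (θ σ) i ⇔ Excl σ i)
    × (∀ i → CycE σ (θ σ) i ⇔ Cyc σ i)
lemma6 n σ = arec σ , erec σ , rar σ , excp σ , excl σ , cyc σ
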